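{- Let $G=(V,E)$ be an undirected graph, $\mathcal{B}$ a family of non-empty subsets of $V$ (bundles) such that every vertex lies in at least one bundle, and $w\colon\mathcal{B}\to\mathbb{Z}_{>0}$. Then there exists a proper coloring $c\colon V\to\mathbb{Z}_{>0}$ minimizing $\mathrm{cost}(c)=\sum_{B\in\mathcal{B}} w(B)\max\{c(v)\mid v\in B\}$ over all proper colorings of $G$ such that $c(v)\le |\delta_G(v)|+1$ for every $v\in V$.
   Context: A proper coloring of $G$ is a map $c\colon V\to\mathbb{Z}_{>0}$ with $c(u)\neq c(v)$ for every edge $uv\in E$. $\delta_G(v)$ denotes the set of edges incident to $v$. -}

module Defs where

open import Data.Nat using (ℕ; _+_; _*_; _⊔_; _≤_; _<_)
open import Data.Fin using (Fin)
open import Data.Fin.Subset using (Subset; _∈_; Nonempty)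
open import Data.Bool using (Bool; true; false; if_then_else_)
open import Data.Vec using (lookup)
open import Data.List using (List; map; foldr; allFin)
open import Data.Nat.ListAction using (sum)
open import Data.Product using (∃; _×_)
open import Relation.Binary.PropositionalEquality using (_≡_; _≢_)

record Graph (n : ℕ) : Set where
  field
    adj       : Fin n → Fin n → Bool
    adj-sym   : ∀ u v → adj u v ≡ adj v u
    adj-irrefl : ∀ v → adj v v ≡ false
open Graph public

degree : ∀ {n} → Graph n → Fin n → ℕ
degree G v = sum (map (λ u → if adj G v u then 1 else 0) (allFin _))

IsProperColoring : ∀ {n} → Graph n → (Fin n → ℕ) → Set
IsProperColoring G c =
  (∀ v → 1 ≤ c v) × (∀ u v → adj G u v ≡ true → c u ≢ c v)

-- max { c v | v ∈ S }  (S is non-empty in the uses below; lookup S v = true iff v ∈ S)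
maxOn : ∀ {n} → (Fin n → ℕ) → Subset n → ℕ
maxOn {n} c S = foldr (λ v acc → (if lookup S v then c v else 0) ⊔ acc) 0 (allFin n)

cost : ∀ {n m} → (Fin m → Subset n) → (Fin m → ℕ) → (Fin n → ℕ) → ℕ
cost {m = m} 𝓑 w c = sum (map (λ i → w i * maxOn c (𝓑 i)) (allFin m))

-- Lowering the colour of one vertex never increases the cost, because cost is
-- monotone in every colour whatever the bundles and weights are. A vertex v
-- coloured above |δ(v)| + 1 can be recoloured with one of 1, …, |δ(v)| + 1:
-- its neighbours use at most |δ(v)| colours (pigeonhole). Doing this at every
-- vertex, each proper colouring is dominated pointwise by a proper colouring
-- with c(v) ≤ |δ(v)| + 1. These form a finite set, so one of them has least
-- cost, and it is then optimal among all proper colourings.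
module Submission where

open import Defs
open import Data.Nat using (ℕ; _≤_; _<_; _+_; suc; z≤n; s≤s; _⊔_; _≤?_; _≟_)
open import Data.Fin using (Fin; zero; suc; toℕ)
open import Data.Fin.Subset using (Subset; _∈_; Nonempty)
open import Data.Product using (∃; Σ; _×_; _,_; proj₁; proj₂)

open import Data.Bool using (Bool; true; false; if_then_else_) renaming (_≟_ to _≟ᵇ_)
open import Data.Bool.Properties using (T-≡)
open import Data.Fin.Properties
  using (<⇒≢; toℕ<n; toℕ-injective; pigeonhole; all?; any?) renaming (_≟_ to _≟ᶠ_)
open import Data.List
  using (List; []; _∷_; [_]; length; map; foldr; allFin; lookup; upTo; filter; filterᵇ; cartesianProductWith)
open import Data.List.Properties using (length-map)
open import Data.List.Membership.Propositional using () renaming (_∈_ to _∈ˡ_; _∉_ to _∉ˡ_)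
open import Data.List.Membership.Propositional.Properties
  using (∈-map⁺; ∈-filter⁺; ∈-filter⁻; ∈-allFin; ∈-upTo⁺; ∈-cartesianProductWith⁺)
open import Data.List.Membership.DecPropositional Data.Nat._≟_ using (_∈?_; _∉?_)
open import Data.List.Relation.Unary.All using (All)
import Data.List.Relation.Unary.All as All
open import Data.List.Relation.Unary.All.Properties using (all-filter)
open import Data.List.Relation.Unary.Any using (here; there; index)
open import Data.List.Relation.Unary.Any.Properties using (lookup-index)
open import Data.Nat.ListAction using (sum)
open import Data.Nat.Properties
  using (≤-refl; ≤-trans; <⇒≤; ≰⇒>; m<m+n; +-mono-≤; *-monoʳ-≤; ⊔-mono-≤; suc-injective; ≤-totalOrder)
open import Data.List.Extrema ≤-totalOrder using (argmin; argmin-all; f[argmin]≤f[xs])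
open import Data.Vec using () renaming (lookup to lookupᵛ)
open import Data.Vec.Functional as Vector using (updateAt; head; tail)
open import Data.Vec.Functional.Properties using (updateAt-updates; updateAt-minimal)
open import Function using (_∘_; const; Equivalence)
open import Function.Definitions using (Injective)
open import Relation.Binary.PropositionalEquality
  using (_≡_; _≢_; _≗_; refl; sym; trans; cong; subst; module ≡-Reasoning)
open import Relation.Nullary using (Dec; yes; no; ¬_; ¬?; contradiction)
open import Relation.Nullary.Decidable using (_×-dec_; _→-dec_; decidable-stable)

private
  variable
    n : ℕ
    A : Set

infix 4 _≤̇_

_≤̇_ : (Fin n → ℕ) → (Fin n → ℕ) → Set
c ≤̇ c′ = ∀ v → c v ≤ c′ v

≗-≤̇-trans : {f g h : Fin n → ℕ} → f ≗ g → g ≤̇ h → f ≤̇ h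
≗-≤̇-trans f≗g g≤h v = subst (_≤ _) (sym (f≗g v)) (g≤h v)

pigeonhole-∈ : (xs : List A) {e : Fin (length xs + 1) → A} → Injective _≡_ _≡_ e →
  ¬ (∀ j → e j ∈ˡ xs)
pigeonhole-∈ xs {e} e-injective member
  with pigeonhole (m<m+n (length xs) (s≤s z≤n)) (index ∘ member)
... | i , j , i<j , same-index = <⇒≢ i<j (e-injective same-element)
  where
    open ≡-Reasoning
    same-element : e i ≡ e j
    same-element = begin
      e i                             ≡⟨ lookup-index (member i) ⟩
      lookup xs (index (member i))    ≡⟨ cong (lookup xs) same-index ⟩
      lookup xs (index (member j))    ≡⟨ lookup-index (member j) ⟨
      e j                             ∎

∃-colour∉ : (xs : List ℕ) → ∃ λ k → 1 ≤ k × k ≤ length xs + 1 × k ∉ˡ xs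
∃-colour∉ xs with any? (λ (j : Fin (length xs + 1)) → suc (toℕ j) ∉? xs)
... | yes (j , j∉) = suc (toℕ j) , s≤s z≤n , toℕ<n j , j∉
... | no ¬free = contradiction member (pigeonhole-∈ xs (toℕ-injective ∘ suc-injective))
  where
    member : ∀ j → suc (toℕ j) ∈ˡ xs
    member j = decidable-stable (suc (toℕ j) ∈? xs) (λ j∉ → ¬free (j , j∉))

length-filterᵇ : (p : A → Bool) (xs : List A) →
  length (filterᵇ p xs) ≡ sum (map (λ x → if p x then 1 else 0) xs)
length-filterᵇ p [] = refl
length-filterᵇ p (x ∷ xs) with p x
... | true  = cong suc (length-filterᵇ p xs)
... | false = length-filterᵇ p xs

neighbours : Graph n → Fin n → List (Fin n)
neighbours G v = filterᵇ (adj G v) (allFin _)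

length-neighbours : (G : Graph n) (v : Fin n) → length (neighbours G v) ≡ degree G v
length-neighbours G v = length-filterᵇ (adj G v) (allFin _)

∈-neighbours : (G : Graph n) {v u : Fin n} → adj G v u ≡ true → u ∈ˡ neighbours G v
∈-neighbours G v~u = ∈-filter⁺ _ (∈-allFin _) (Equivalence.from T-≡ v~u)

∃-colour-unused-by-neighbours : (G : Graph n) (c : Fin n → ℕ) (v : Fin n) →
  ∃ λ k → 1 ≤ k × k ≤ degree G v + 1 × (∀ u → adj G v u ≡ true → c u ≢ k)
∃-colour-unused-by-neighbours G c v with ∃-colour∉ (map c (neighbours G v))
... | k , 1≤k , k≤ , k∉ = k , 1≤k , k≤degree+1 , unused
  where
    k≤degree+1 : k ≤ degree G v + 1
    k≤degree+1 = subst (λ d → k ≤ d + 1)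
      (trans (length-map c (neighbours G v)) (length-neighbours G v)) k≤
    unused : ∀ u → adj G v u ≡ true → c u ≢ k
    unused u v~u refl = k∉ (∈-map⁺ c (∈-neighbours G v~u))

updateAt-≤̇ : (c : Fin n → ℕ) (v : Fin n) {k : ℕ} → k ≤ c v → updateAt c v (const k) ≤̇ c
updateAt-≤̇ c v {k} k≤cv u with u ≟ᶠ v
... | yes refl rewrite updateAt-updates u {const k} c = k≤cv
... | no u≢v   rewrite updateAt-minimal u v {const k} c u≢v = ≤-refl

updateAt-isProperColoring : (G : Graph n) {c : Fin n → ℕ} (v : Fin n) {k : ℕ} →
  IsProperColoring G c → 1 ≤ k → (∀ u → adj G v u ≡ true → c u ≢ k) →
  IsProperColoring G (updateAt c v (const k))
updateAt-isProperColoring G {c} v {k} (positive , distinct) 1≤k unused = positive′ , distinct′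
  where
    c′ = updateAt c v (const k)

    at-v : c′ v ≡ k
    at-v = updateAt-updates v c

    off-v : ∀ {u} → u ≢ v → c′ u ≡ c u
    off-v u≢v = updateAt-minimal _ v c u≢v

    positive′ : ∀ u → 1 ≤ c′ u
    positive′ u with u ≟ᶠ v
    ... | yes refl rewrite at-v = 1≤k
    ... | no u≢v rewrite off-v u≢v = positive u

    distinct′ : ∀ u w → adj G u w ≡ true → c′ u ≢ c′ w
    distinct′ u w u~w with u ≟ᶠ v | w ≟ᶠ v
    ... | yes refl | yes refl = contradiction (trans (sym u~w) (adj-irrefl G u)) λ ()
    ... | yes refl | no w≢v rewrite at-v | off-v w≢v = unused w u~w ∘ sym
    ... | no u≢v | yes refl rewrite at-v | off-v u≢v = unused u (trans (adj-sym G w u) u~w)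
    ... | no u≢v | no w≢v rewrite off-v u≢v | off-v w≢v = distinct u w u~w

degreeBound : Graph n → Fin n → ℕ
degreeBound G v = degree G v + 1

ProperColoringBelow : Graph n → (Fin n → ℕ) → (Fin n → Set) → Set
ProperColoringBelow {n} G c Bounded =
  Σ (Fin n → ℕ) λ c′ → IsProperColoring G c′ × c′ ≤̇ c × (∀ v → Bounded v → c′ v ≤ degreeBound G v)

lower-at : (G : Graph n) {c : Fin n → ℕ} → IsProperColoring G c → (v : Fin n) →
  ProperColoringBelow G c (_≡ v)
lower-at G {c} proper v with c v ≤? degreeBound G v
... | yes cv≤ = c , proper , (λ _ → ≤-refl) , λ { _ refl → cv≤ }
... | no cv≰ with ∃-colour-unused-by-neighbours G c v
...   | k , 1≤k , k≤ , unused =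
  updateAt c v (const k) ,
  updateAt-isProperColoring G v proper 1≤k unused ,
  updateAt-≤̇ c v (≤-trans k≤ (<⇒≤ (≰⇒> cv≰))) ,
  λ { _ refl → subst (_≤ degreeBound G v) (sym (updateAt-updates v {const k} c)) k≤ }

lower-on : (G : Graph n) {c : Fin n → ℕ} → IsProperColoring G c → (vs : List (Fin n)) →
  ProperColoringBelow G c (_∈ˡ vs)
lower-on G {c} proper [] = c , proper , (λ _ → ≤-refl) , λ _ ()
lower-on G proper (v ∷ vs) with lower-on G proper vs
... | c₁ , proper₁ , c₁≤c , bounded₁ with lower-at G proper₁ v
...   | c₂ , proper₂ , c₂≤c₁ , bounded₂ = c₂ , proper₂ , (λ u → ≤-trans (c₂≤c₁ u) (c₁≤c u)) , bounded
  where
    bounded : ∀ u → u ∈ˡ v ∷ vs → c₂ u ≤ degreeBound G u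
    bounded u (here u≡v) = bounded₂ u u≡v
    bounded u (there u∈vs) = ≤-trans (c₂≤c₁ u) (bounded₁ u u∈vs)

lower : (G : Graph n) {c : Fin n → ℕ} → IsProperColoring G c →
  Σ (Fin n → ℕ) λ c′ → IsProperColoring G c′ × c′ ≤̇ c × c′ ≤̇ degreeBound G
lower G proper with lower-on G proper (allFin _)
... | c′ , proper′ , c′≤c , bounded = c′ , proper′ , c′≤c , λ v → bounded v (∈-allFin v)

maxOn-mono : {c c′ : Fin n → ℕ} (S : Subset n) → c ≤̇ c′ → maxOn c S ≤ maxOn c′ S
maxOn-mono {n} {c} {c′} S c≤c′ = go (allFin n)
  where
    masked : (Fin n → ℕ) → Fin n → ℕ
    masked f v = if lookupᵛ S v then f v else 0

    masked-mono : ∀ v → masked c v ≤ masked c′ v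
    masked-mono v with lookupᵛ S v
    ... | true  = c≤c′ v
    ... | false = z≤n

    go : (vs : List (Fin n)) →
      foldr (λ v acc → masked c v ⊔ acc) 0 vs ≤ foldr (λ v acc → masked c′ v ⊔ acc) 0 vs
    go [] = z≤n
    go (v ∷ vs) = ⊔-mono-≤ (masked-mono v) (go vs)

sum-map-mono : {f g : A → ℕ} → (∀ x → f x ≤ g x) → (xs : List A) → sum (map f xs) ≤ sum (map g xs)
sum-map-mono f≤g [] = z≤n
sum-map-mono f≤g (x ∷ xs) = +-mono-≤ (f≤g x) (sum-map-mono f≤g xs)

cost-mono : ∀ {m} (𝓑 : Fin m → Subset n) (w : Fin m → ℕ) {c c′ : Fin n → ℕ} →
  c ≤̇ c′ → cost 𝓑 w c ≤ cost 𝓑 w c′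
cost-mono 𝓑 w c≤c′ = sum-map-mono (λ i → *-monoʳ-≤ (w i) (maxOn-mono (𝓑 i) c≤c′)) (allFin _)

functionsBelow : (b : Fin n → ℕ) → List (Fin n → ℕ)
functionsBelow {ℕ.zero} b = [ Vector.[] ]
functionsBelow {suc n} b = cartesianProductWith Vector._∷_ (upTo (suc (head b))) (functionsBelow (tail b))

∈-functionsBelow : (b c : Fin n → ℕ) → c ≤̇ b → ∃ λ f → f ∈ˡ functionsBelow b × f ≗ c
∈-functionsBelow {ℕ.zero} b c c≤b = Vector.[] , here refl , λ ()
∈-functionsBelow {suc n} b c c≤b with ∈-functionsBelow (tail b) (tail c) (c≤b ∘ suc)
... | f , f∈ , f≗tail =
  head c Vector.∷ f , ∈-cartesianProductWith⁺ Vector._∷_ (∈-upTo⁺ (s≤s (c≤b zero))) f∈ , agree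
  where
    agree : head c Vector.∷ f ≗ c
    agree zero = refl
    agree (suc v) = f≗tail v

isProperColoring-resp-≗ : (G : Graph n) {c c′ : Fin n → ℕ} → c ≗ c′ →
  IsProperColoring G c → IsProperColoring G c′
isProperColoring-resp-≗ G c≗c′ (positive , distinct) =
  (λ v → subst (1 ≤_) (c≗c′ v) (positive v)) ,
  (λ u w u~w c′u≡c′w → distinct u w u~w (trans (c≗c′ u) (trans c′u≡c′w (sym (c≗c′ w)))))

isProperColoring? : (G : Graph n) (c : Fin n → ℕ) → Dec (IsProperColoring G c)
isProperColoring? G c =
  all? (λ v → 1 ≤? c v) ×-dec
  all? (λ u → all? (λ w → (adj G u w ≟ᵇ true) →-dec ¬? (c u ≟ c w)))

injective⇒isProperColoring : (G : Graph n) {c : Fin n → ℕ} → Injective _≡_ _≡_ c →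
  (∀ v → 1 ≤ c v) → IsProperColoring G c
injective⇒isProperColoring G injective positive = positive , distinct
  where
    distinct : ∀ u w → adj G u w ≡ true → _
    distinct u w u~w cu≡cw with injective cu≡cw
    ... | refl = contradiction (trans (sym u~w) (adj-irrefl G u)) λ ()

IsBoundedProperColoring : Graph n → (Fin n → ℕ) → Set
IsBoundedProperColoring G c = IsProperColoring G c × c ≤̇ degreeBound G

isBoundedProperColoring? : (G : Graph n) (c : Fin n → ℕ) → Dec (IsBoundedProperColoring G c)
isBoundedProperColoring? G c = isProperColoring? G c ×-dec all? (λ v → c v ≤? degreeBound G v)

boundedProperColorings : Graph n → List (Fin n → ℕ)
boundedProperColorings G = filter (isBoundedProperColoring? G) (functionsBelow (degreeBound G))

∈-boundedProperColorings⁻ : (G : Graph n) {f : Fin n → ℕ} →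
  f ∈ˡ boundedProperColorings G → IsBoundedProperColoring G f
∈-boundedProperColorings⁻ G f∈ =
  proj₂ (∈-filter⁻ (isBoundedProperColoring? G) {xs = functionsBelow (degreeBound G)} f∈)

all-boundedProperColorings : (G : Graph n) → All (IsBoundedProperColoring G) (boundedProperColorings G)
all-boundedProperColorings G = all-filter (isBoundedProperColoring? G) (functionsBelow (degreeBound G))

dominated-by-boundedProperColoring : (G : Graph n) {c : Fin n → ℕ} → IsProperColoring G c →
  ∃ λ f → f ∈ˡ boundedProperColorings G × f ≤̇ c
dominated-by-boundedProperColoring G proper with lower G proper
... | c′ , proper′ , c′≤c , bounded with ∈-functionsBelow (degreeBound G) c′ bounded
...   | f , f∈ , f≗c′ = f , ∈-filter⁺ _ f∈ f-good , ≗-≤̇-trans f≗c′ c′≤c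
  where
    f-good : IsBoundedProperColoring G f
    f-good = isProperColoring-resp-≗ G (sym ∘ f≗c′) proper′ , ≗-≤̇-trans f≗c′ bounded

-- The hypotheses on bundles and weights are unused: cost-mono holds without them.
mainTheorem1 : ∀ {n m} (G : Graph n) (𝓑 : Fin m → Subset n) (w : Fin m → ℕ) →
    (∀ i → Nonempty (𝓑 i)) →
    (∀ v → ∃ λ i → v ∈ 𝓑 i) →
    (∀ i → 0 < w i) →
    Σ (Fin n → ℕ) λ c →
      IsProperColoring G c ×
      (∀ c′ → IsProperColoring G c′ → cost 𝓑 w c ≤ cost 𝓑 w c′) ×
      (∀ v → c v ≤ degree G v + 1)
mainTheorem1 G 𝓑 w _ _ _ = c* , proj₁ c*-good , optimal , proj₂ c*-good
  where
    distinctColours : IsProperColoring G (suc ∘ toℕ)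
    distinctColours = injective⇒isProperColoring G (toℕ-injective ∘ suc-injective) (λ _ → s≤s z≤n)

    below-distinctColours = dominated-by-boundedProperColoring G distinctColours
    c₀ = proj₁ below-distinctColours
    c₀∈ = proj₁ (proj₂ below-distinctColours)
    c* = argmin (cost 𝓑 w) c₀ (boundedProperColorings G)

    c*-good : IsBoundedProperColoring G c*
    c*-good = argmin-all (cost 𝓑 w) (∈-boundedProperColorings⁻ G c₀∈) (all-boundedProperColorings G)

    optimal : ∀ c′ → IsProperColoring G c′ → cost 𝓑 w c* ≤ cost 𝓑 w c′
    optimal c′ proper′ with dominated-by-boundedProperColoring G proper′
    ... | f , f∈ , f≤c′ =
      ≤-trans (All.lookup (f[argmin]≤f[xs] c₀ (boundedProperColorings G)) f∈) (cost-mono 𝓑 w f≤c′)
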